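{- Let $n>1$ and $d$ be integers. Then $$\sum_{k=1}^{n-1}\binom nk\left(\frac{d+k}{3}\right)=\bigl(1+(-1)^n-3[3\mid n]\bigr)\left(\frac{d-n}{3}\right).$$
   Context: For an integer $x$, $\left(\frac{x}{3}\right)\in\{0,1,-1\}$ denotes the Legendre symbol modulo 3, i.e. the unique element of $\{0,\pm1\}$ congruent to $x$ modulo 3. For an assertion $A$, $[A]$ equals $1$ if $A$ holds and $0$ otherwise. -}

module Defs where

open import Data.Nat using (ℕ; zero; suc) renaming (_%_ to _%ⁿ_)
open import Data.Integer using (ℤ; +_; -_; _+_; _*_; _-_)
open import Data.Integer.DivMod using (_%ℕ_)
open import Data.Nat.Combinatorics using (_C_)

legendre3 : ℤ → ℤ
legendre3 x with x %ℕ 3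
... | 0 = + 0
... | 1 = + 1
... | _ = - (+ 1)

-- Σ_{k=a}^{b} f k  (empty if b < a), as a sum of integers: sumFromTo a b f
-- here defined as Σ_{k = a}^{a + m - 1} f k with m terms.
sumFrom : ℕ → ℕ → (ℕ → ℤ) → ℤ
sumFrom a zero    f = + 0
sumFrom a (suc m) f = f a + sumFrom (suc a) m f

negOnePow : ℕ → ℤ
negOnePow zero = + 1
negOnePow (suc n) = - negOnePow n

iver3∣ : ℕ → ℤ
iver3∣ n with n %ⁿ 3
... | 0 = + 1
... | _ = + 0

module Submission where

-- Write χ for the Legendre symbol modulo 3 and T(n, d) = Σ_{k=0}^{n} C(n,k) χ(d+k).
--
-- A check over the nine residue pairs gives the "orbit
--    identity"  χ(x+n) + χ(x+2n) = (3[3∣n] − 1) χ(x); for n = 1 it says that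
--    χ sums to zero over three consecutive integers.
-- 2. Binomial sums.  Pascal's rule gives T(n+1, d) = T(n, d+1) + T(n, d), and with
--    the case n = 1 of the orbit identity, induction on n yields
--    T(n, d) = (−1)^n χ(d − n).
-- 3. The theorem.  The requested sum is T(n, d) minus its two boundary terms
--    χ(d) = χ(x+n) and χ(d+n) = χ(x+2n), where x = d − n; the orbit identity
--    evaluates their sum, and a ring normalisation finishes the proof.

open import Defs
open import Data.Nat using (ℕ; _∸_) renaming (_<_ to _<ℕ_)
open import Data.Integer using (ℤ; +_; _+_; _*_; _-_)
open import Data.Nat.Combinatorics using (_C_)
open import Relation.Binary.PropositionalEquality using (_≡_)

open import Data.Nat as ℕ using (zero; suc; s≤s)
open import Data.Nat.DivMod using (_%_; %-distribˡ-+; m%n%n≡m%n; m%n<n; m<n⇒m%n≡m)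
import Data.Nat.Properties as ℕₚ
open import Data.Integer using (-_; -[1+_])
import Data.Integer.Properties as ℤₚ
open import Data.Integer.DivMod using (_%ℕ_; n%ℕd<d)
open import Data.Nat.Combinatorics using (nCn≡1; k>n⇒nCk≡0; nCk+nC[k+1]≡[n+1]C[k+1])
open import Relation.Binary.PropositionalEquality
  using (refl; sym; trans; cong; cong₂; module ≡-Reasoning)
open import Data.Integer.Tactic.RingSolver using (solve-∀)

χ₃ : ℕ → ℤ
χ₃ 0 = + 0
χ₃ 1 = + 1
χ₃ 2 = - (+ 1)
χ₃ (suc (suc (suc a))) = χ₃ a

χ₃-mod : ∀ a → χ₃ (a % 3) ≡ χ₃ a
χ₃-mod 0 = refl
χ₃-mod 1 = refl
χ₃-mod 2 = refl
χ₃-mod (suc (suc (suc a))) = χ₃-mod a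

iver3∣-mod : ∀ n → iver3∣ (n % 3) ≡ iver3∣ n
iver3∣-mod 0 = refl
iver3∣-mod 1 = refl
iver3∣-mod 2 = refl
iver3∣-mod (suc (suc (suc n))) = iver3∣-mod n

χ₃-+ : ∀ a b → χ₃ (a ℕ.+ b) ≡ χ₃ (a % 3 ℕ.+ b % 3)
χ₃-+ a b = trans (sym (χ₃-mod (a ℕ.+ b)))
                 (trans (cong χ₃ (%-distribˡ-+ a b 3)) (χ₃-mod (a % 3 ℕ.+ b % 3)))

χ₃-+-modʳ : ∀ a b → χ₃ (a ℕ.+ b % 3) ≡ χ₃ (a ℕ.+ b)
χ₃-+-modʳ a b = trans (χ₃-+ a (b % 3))
  (trans (cong (λ t → χ₃ (a % 3 ℕ.+ t)) (m%n%n≡m%n b 3)) (sym (χ₃-+ a b)))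

χ₃-orbit-residues : ∀ r s → r <ℕ 3 → s <ℕ 3 →
  χ₃ (r ℕ.+ s) + χ₃ (r ℕ.+ (s ℕ.+ s)) ≡ (+ 3 * iver3∣ s - + 1) * χ₃ r
χ₃-orbit-residues 0 0 _ _ = refl
χ₃-orbit-residues 0 1 _ _ = refl
χ₃-orbit-residues 0 2 _ _ = refl
χ₃-orbit-residues 1 0 _ _ = refl
χ₃-orbit-residues 1 1 _ _ = refl
χ₃-orbit-residues 1 2 _ _ = refl
χ₃-orbit-residues 2 0 _ _ = refl
χ₃-orbit-residues 2 1 _ _ = refl
χ₃-orbit-residues 2 2 _ _ = refl
χ₃-orbit-residues (suc (suc (suc _))) _ (s≤s (s≤s (s≤s ()))) _
χ₃-orbit-residues _ (suc (suc (suc _))) _ (s≤s (s≤s (s≤s ())))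

χ₃-orbit : ∀ a n →
  χ₃ (a ℕ.+ n) + χ₃ (a ℕ.+ (n ℕ.+ n)) ≡ (+ 3 * iver3∣ n - + 1) * χ₃ a
χ₃-orbit a n = begin
    χ₃ (a ℕ.+ n) + χ₃ (a ℕ.+ (n ℕ.+ n))
  ≡⟨ cong₂ _+_ (χ₃-+ a n) (χ₃-+ a (n ℕ.+ n)) ⟩
    χ₃ (r ℕ.+ s) + χ₃ (r ℕ.+ (n ℕ.+ n) % 3)
  ≡⟨ cong (λ t → χ₃ (r ℕ.+ s) + χ₃ (r ℕ.+ t)) (%-distribˡ-+ n n 3) ⟩
    χ₃ (r ℕ.+ s) + χ₃ (r ℕ.+ (s ℕ.+ s) % 3)
  ≡⟨ cong (λ t → χ₃ (r ℕ.+ s) + t) (χ₃-+-modʳ r (s ℕ.+ s)) ⟩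
    χ₃ (r ℕ.+ s) + χ₃ (r ℕ.+ (s ℕ.+ s))
  ≡⟨ χ₃-orbit-residues r s (m%n<n a 3) (m%n<n n 3) ⟩
    (+ 3 * iver3∣ s - + 1) * χ₃ r
  ≡⟨ cong₂ (λ i v → (+ 3 * i - + 1) * v) (iver3∣-mod n) (χ₃-mod a) ⟩
    (+ 3 * iver3∣ n - + 1) * χ₃ a ∎
  where
  open ≡-Reasoning
  r s : ℕ
  r = a % 3
  s = n % 3

legendre3≡χ₃ : ∀ x → legendre3 x ≡ χ₃ (x %ℕ 3)
legendre3≡χ₃ x with x %ℕ 3 | n%ℕd<d x 3
... | 0 | _ = refl
... | 1 | _ = refl
... | 2 | _ = refl
... | suc (suc (suc _)) | s≤s (s≤s (s≤s ()))

%ℕ3-suc : ∀ x → (x + + 1) %ℕ 3 ≡ suc (x %ℕ 3) % 3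
%ℕ3-suc (+ n) = trans (cong (_% 3) (ℕₚ.+-comm n 1)) (%-distribˡ-+ 1 n 3)
%ℕ3-suc -[1+ 0 ] = refl
%ℕ3-suc -[1+ suc n ]
  with suc n % 3 | suc (suc n) % 3 | %-distribˡ-+ 1 (suc n) 3 | m%n<n (suc n) 3
... | 0 | .1 | refl | _ = refl
... | 1 | .2 | refl | _ = refl
... | 2 | .0 | refl | _ = refl
... | suc (suc (suc _)) | _ | _ | s≤s (s≤s (s≤s ()))

%ℕ3-+ : ∀ x m → (x + + m) %ℕ 3 ≡ (x %ℕ 3 ℕ.+ m) % 3
%ℕ3-+ x zero = begin
    (x + + 0) %ℕ 3        ≡⟨ cong (_%ℕ 3) (ℤₚ.+-identityʳ x) ⟩
    x %ℕ 3                ≡⟨ sym (m<n⇒m%n≡m (n%ℕd<d x 3)) ⟩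
    x %ℕ 3 % 3            ≡⟨ cong (_% 3) (sym (ℕₚ.+-identityʳ (x %ℕ 3))) ⟩
    (x %ℕ 3 ℕ.+ 0) % 3    ∎
  where open ≡-Reasoning
%ℕ3-+ x (suc m) = begin
    (x + + suc m) %ℕ 3              ≡⟨ cong (_%ℕ 3) (suc-last x (+ m)) ⟩
    ((x + + m) + + 1) %ℕ 3          ≡⟨ %ℕ3-suc (x + + m) ⟩
    suc ((x + + m) %ℕ 3) % 3        ≡⟨ cong (λ t → suc t % 3) (%ℕ3-+ x m) ⟩
    suc ((x %ℕ 3 ℕ.+ m) % 3) % 3    ≡⟨ sym (%-distribˡ-+ 1 (x %ℕ 3 ℕ.+ m) 3) ⟩
    suc (x %ℕ 3 ℕ.+ m) % 3          ≡⟨ cong (_% 3) (sym (ℕₚ.+-suc (x %ℕ 3) m)) ⟩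
    (x %ℕ 3 ℕ.+ suc m) % 3          ∎
  where
  open ≡-Reasoning
  suc-last : ∀ x y → x + (+ 1 + y) ≡ (x + y) + + 1
  suc-last = solve-∀

legendre3-shift : ∀ x m → legendre3 (x + + m) ≡ χ₃ (x %ℕ 3 ℕ.+ m)
legendre3-shift x m = trans (legendre3≡χ₃ (x + + m))
  (trans (cong χ₃ (%ℕ3-+ x m)) (χ₃-mod (x %ℕ 3 ℕ.+ m)))

legendre3-orbit : ∀ x n →
  legendre3 (x + + n) + legendre3 (x + + (n ℕ.+ n)) ≡ (+ 3 * iver3∣ n - + 1) * legendre3 x
legendre3-orbit x n = begin
    legendre3 (x + + n) + legendre3 (x + + (n ℕ.+ n))
  ≡⟨ cong₂ _+_ (legendre3-shift x n) (legendre3-shift x (n ℕ.+ n)) ⟩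
    χ₃ (x %ℕ 3 ℕ.+ n) + χ₃ (x %ℕ 3 ℕ.+ (n ℕ.+ n))
  ≡⟨ χ₃-orbit (x %ℕ 3) n ⟩
    (+ 3 * iver3∣ n - + 1) * χ₃ (x %ℕ 3)
  ≡⟨ cong ((+ 3 * iver3∣ n - + 1) *_) (sym (legendre3≡χ₃ x)) ⟩
    (+ 3 * iver3∣ n - + 1) * legendre3 x ∎
  where open ≡-Reasoning

sumFrom-cong : ∀ a m {f g : ℕ → ℤ} → (∀ k → f k ≡ g k) → sumFrom a m f ≡ sumFrom a m g
sumFrom-cong a zero    f≡g = refl
sumFrom-cong a (suc m) f≡g = cong₂ _+_ (f≡g a) (sumFrom-cong (suc a) m f≡g)

sumFrom-shift : ∀ a m (f : ℕ → ℤ) → sumFrom (suc a) m f ≡ sumFrom a m (λ k → f (suc k))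
sumFrom-shift a zero    f = refl
sumFrom-shift a (suc m) f = cong (_+_ (f (suc a))) (sumFrom-shift (suc a) m f)

sumFrom-+ : ∀ a m (f g : ℕ → ℤ) →
  sumFrom a m (λ k → f k + g k) ≡ sumFrom a m f + sumFrom a m g
sumFrom-+ a zero    f g = refl
sumFrom-+ a (suc m) f g =
  trans (cong (_+_ (f a + g a)) (sumFrom-+ (suc a) m f g)) (interchange (f a) (g a) _ _)
  where
  interchange : ∀ p q r s → (p + q) + (r + s) ≡ (p + r) + (q + s)
  interchange = solve-∀

sumFrom-snoc : ∀ a m (f : ℕ → ℤ) → sumFrom a (suc m) f ≡ sumFrom a m f + f (a ℕ.+ m)
sumFrom-snoc a zero f = begin
    f a + + 0       ≡⟨ ℤₚ.+-identityʳ (f a) ⟩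
    f a             ≡⟨ cong f (sym (ℕₚ.+-identityʳ a)) ⟩
    f (a ℕ.+ 0)     ≡⟨ sym (ℤₚ.+-identityˡ (f (a ℕ.+ 0))) ⟩
    + 0 + f (a ℕ.+ 0) ∎
  where open ≡-Reasoning
sumFrom-snoc a (suc m) f = begin
    f a + sumFrom (suc a) (suc m) f
  ≡⟨ cong (_+_ (f a)) (sumFrom-snoc (suc a) m f) ⟩
    f a + (sumFrom (suc a) m f + f (suc a ℕ.+ m))
  ≡⟨ sym (ℤₚ.+-assoc (f a) _ _) ⟩
    f a + sumFrom (suc a) m f + f (suc a ℕ.+ m)
  ≡⟨ cong (λ k → f a + sumFrom (suc a) m f + f k) (sym (ℕₚ.+-suc a m)) ⟩
    f a + sumFrom (suc a) m f + f (a ℕ.+ suc m) ∎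
  where open ≡-Reasoning

binomialSum : ℕ → (ℕ → ℤ) → ℤ
binomialSum n g = sumFrom 0 (suc n) (λ k → + (n C k) * g k)

binomialSum-cong : ∀ n {g h : ℕ → ℤ} → (∀ k → g k ≡ h k) → binomialSum n g ≡ binomialSum n h
binomialSum-cong n g≡h = sumFrom-cong 0 (suc n) (λ k → cong (+ (n C k) *_) (g≡h k))

pascal-term : ∀ n k (g : ℕ → ℤ) →
  + (suc n C suc k) * g (suc k) ≡ + (n C k) * g (suc k) + + (n C suc k) * g (suc k)
pascal-term n k g = begin
    + (suc n C suc k) * g (suc k)
  ≡⟨ cong (λ c → + c * g (suc k)) (sym (nCk+nC[k+1]≡[n+1]C[k+1] n k)) ⟩
    + (n C k ℕ.+ n C suc k) * g (suc k)
  ≡⟨ cong (_* g (suc k)) (ℤₚ.pos-+ (n C k) (n C suc k)) ⟩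
    (+ (n C k) + + (n C suc k)) * g (suc k)
  ≡⟨ ℤₚ.*-distribʳ-+ (g (suc k)) (+ (n C k)) (+ (n C suc k)) ⟩
    + (n C k) * g (suc k) + + (n C suc k) * g (suc k) ∎
  where open ≡-Reasoning

binomialSum-pascal : ∀ n (g : ℕ → ℤ) →
  binomialSum (suc n) g ≡ binomialSum n (λ k → g (suc k)) + binomialSum n g
binomialSum-pascal n g = begin
    binomialSum (suc n) g
  ≡⟨ cong (_+_ (t 0)) (sumFrom-shift 0 (suc n) (term (suc n))) ⟩
    t 0 + sumFrom 0 (suc n) (λ k → term (suc n) (suc k))
  ≡⟨ cong (_+_ (t 0)) (sumFrom-cong 0 (suc n) (λ k → pascal-term n k g)) ⟩
    t 0 + sumFrom 0 (suc n) (λ k → + (n C k) * g (suc k) + t (suc k))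
  ≡⟨ cong (_+_ (t 0)) (sumFrom-+ 0 (suc n) (λ k → + (n C k) * g (suc k)) (λ k → t (suc k))) ⟩
    t 0 + (binomialSum n (λ k → g (suc k)) + sumFrom 0 (suc n) (λ k → t (suc k)))
  ≡⟨ swap (t 0) (binomialSum n (λ k → g (suc k))) _ ⟩
    binomialSum n (λ k → g (suc k)) + (t 0 + sumFrom 0 (suc n) (λ k → t (suc k)))
  ≡⟨ cong (λ u → binomialSum n (λ k → g (suc k)) + (t 0 + u)) (sym (sumFrom-shift 0 (suc n) t)) ⟩
    binomialSum n (λ k → g (suc k)) + sumFrom 0 (suc (suc n)) t
  ≡⟨ cong (_+_ (binomialSum n (λ k → g (suc k)))) (sumFrom-snoc 0 (suc n) t) ⟩
    binomialSum n (λ k → g (suc k)) + (binomialSum n g + t (suc n))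
  ≡⟨ cong (λ u → binomialSum n (λ k → g (suc k)) + (binomialSum n g + u)) vanishing-term ⟩
    binomialSum n (λ k → g (suc k)) + (binomialSum n g + + 0)
  ≡⟨ cong (_+_ (binomialSum n (λ k → g (suc k)))) (ℤₚ.+-identityʳ (binomialSum n g)) ⟩
    binomialSum n (λ k → g (suc k)) + binomialSum n g ∎
  where
  open ≡-Reasoning
  term : ℕ → ℕ → ℤ
  term m k = + (m C k) * g k
  t : ℕ → ℤ
  t = term n
  swap : ∀ p q r → p + (q + r) ≡ q + (p + r)
  swap = solve-∀
  vanishing-term : t (suc n) ≡ + 0
  vanishing-term = trans (cong (λ c → + c * g (suc n)) (k>n⇒nCk≡0 (ℕₚ.n<1+n n)))
                         (ℤₚ.*-zeroˡ (g (suc n)))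

binomialSum-legendre3 : ∀ n d →
  binomialSum n (λ k → legendre3 (d + + k)) ≡ negOnePow n * legendre3 (d - + n)
binomialSum-legendre3 zero d = ℤₚ.+-identityʳ _
binomialSum-legendre3 (suc n) d = begin
    binomialSum (suc n) (λ k → legendre3 (d + + k))
  ≡⟨ binomialSum-pascal n (λ k → legendre3 (d + + k)) ⟩
    binomialSum n (λ k → legendre3 (d + + suc k)) + binomialSum n (λ k → legendre3 (d + + k))
  ≡⟨ cong (_+ binomialSum n (λ k → legendre3 (d + + k)))
          (binomialSum-cong n (λ k → cong legendre3 (regroup-one d (+ k)))) ⟩
    binomialSum n (λ k → legendre3 ((d + + 1) + + k)) + binomialSum n (λ k → legendre3 (d + + k))
  ≡⟨ cong₂ _+_ (binomialSum-legendre3 n (d + + 1)) (binomialSum-legendre3 n d) ⟩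
    e * legendre3 ((d + + 1) - + n) + e * legendre3 (d - + n)
  ≡⟨ cong₂ (λ p q → e * legendre3 p + e * legendre3 q) (plus-two d (+ n)) (plus-one d (+ n)) ⟩
    e * legendre3 (y + + 2) + e * legendre3 (y + + 1)
  ≡⟨ factor e _ _ ⟩
    e * (legendre3 (y + + 1) + legendre3 (y + + 2))
  ≡⟨ cong (e *_) (legendre3-orbit y 1) ⟩   -- three consecutive values sum to 0
    e * ((+ 3 * + 0 - + 1) * legendre3 y)
  ≡⟨ negate e (legendre3 y) ⟩
    negOnePow (suc n) * legendre3 (d - + suc n) ∎
  where
  open ≡-Reasoning
  e y : ℤ
  e = negOnePow n
  y = d - + suc n
  regroup-one : ∀ x m → x + (+ 1 + m) ≡ (x + + 1) + m
  regroup-one = solve-∀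
  plus-two : ∀ x m → (x + + 1) - m ≡ (x - (+ 1 + m)) + + 2
  plus-two = solve-∀
  plus-one : ∀ x m → x - m ≡ (x - (+ 1 + m)) + + 1
  plus-one = solve-∀
  factor : ∀ e p q → e * p + e * q ≡ e * (q + p)
  factor = solve-∀
  negate : ∀ e v → e * ((+ 3 * + 0 - + 1) * v) ≡ - e * v
  negate = solve-∀

lemma2p3 : (n : ℕ) → 1 <ℕ n → (d : ℤ) →
    sumFrom 1 (n ∸ 1) (λ k → (+ (n C k)) * legendre3 (d + (+ k)))
      ≡ ((+ 1 + negOnePow n) - (+ 3) * iver3∣ n) * legendre3 (d - (+ n))
lemma2p3 (suc zero) (s≤s ()) d
lemma2p3 (suc (suc m)) _ d = begin
    S
  ≡⟨ isolate t₀ S tₙ ⟩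
    (t₀ + (S + tₙ)) - (t₀ + tₙ)
  ≡⟨ cong₂ _-_ full-sum (cong₂ _+_ first-term last-term) ⟩
    e * legendre3 x - (legendre3 (x + + n) + legendre3 (x + + (n ℕ.+ n)))
  ≡⟨ cong (_-_ (e * legendre3 x)) (legendre3-orbit x n) ⟩
    e * legendre3 x - (+ 3 * i - + 1) * legendre3 x
  ≡⟨ collect e i (legendre3 x) ⟩
    ((+ 1 + e) - + 3 * i) * legendre3 x ∎
  where
  open ≡-Reasoning
  add-zero : ∀ y c → y + + 0 ≡ (y - c) + c
  add-zero = solve-∀
  isolate : ∀ a s b → s ≡ (a + (s + b)) - (a + b)
  isolate = solve-∀
  add-twice : ∀ y c → y + c ≡ (y - c) + (c + c)
  add-twice = solve-∀
  collect : ∀ e i v → e * v - (+ 3 * i - + 1) * v ≡ ((+ 1 + e) - + 3 * i) * v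
  collect = solve-∀
  n : ℕ
  n = suc (suc m)
  x e i : ℤ
  x = d - + n
  e = negOnePow n
  i = iver3∣ n
  t : ℕ → ℤ
  t k = + (n C k) * legendre3 (d + + k)
  t₀ tₙ S : ℤ
  t₀ = t 0
  tₙ = t n
  S = sumFrom 1 (suc m) t
  full-sum : t₀ + (S + tₙ) ≡ e * legendre3 x
  full-sum = trans (cong (_+_ t₀) (sym (sumFrom-snoc 1 (suc m) t))) (binomialSum-legendre3 n d)
  first-term : t₀ ≡ legendre3 (x + + n)
  first-term = trans (ℤₚ.*-identityˡ _) (cong legendre3 (add-zero d (+ n)))
  last-term : tₙ ≡ legendre3 (x + + (n ℕ.+ n))
  last-term = trans (cong₂ (λ c y → + c * legendre3 y) (nCn≡1 n)
                           (trans (add-twice d (+ n)) (cong (_+_ x) (sym (ℤₚ.pos-+ n n)))))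
                    (ℤₚ.*-identityˡ _)
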